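{- Let $b\ge 1$, $h \ge 0$ be integers and let $\mathcal{T}(r,h,b+1)$ be the rooted tree with root $r$ and height $h$ in which every non-leaf vertex has exactly $b+1$ children and every leaf is at distance exactly $h$ from $r$. If the fire breaks out at $r$, then for every valid strategy with respect to budget $b$, at least one leaf of $\mathcal{T}(r,h,b+1)$ is not saved.
   Context: Firefighter process with budget $b$: given a graph $G=(V,E)$ and a vertex $s\in V$ (here $s=r$), at time $0$ the vertex $s$ is burned and every other vertex is vulnerable. A protection strategy is a set $\Phi \subseteq V \times \{1,\dots,|V|\}$; vertex $v$ is protected at time $t$ if $(v,t)\in\Phi$. At each time step $t \ge 1$, the vertices $v$ with $(v,t)\in \Phi$ become protected (and stay protected forever), and then every vulnerable vertex (neither burned nor protected) adjacent to a burned vertex becomes burned at time $t+1$. $\Phi$ is valid with respect to budget $b$ if (1) whenever $(v,t)\in\Phi$, $v$ is not burned at time $t$, and (2) for each $t$, at most $b$ pairs $(v,t)$ lie in $\Phi$. A vertex is saved if it is protected or every path from a burned vertex to it contains a protected vertex. -}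

module Defs where

open import Data.Nat using (ℕ; zero; suc; _+_; _^_; _≤_; _<_)
open import Data.Fin using (Fin)
open import Data.List using (List; []; _∷_; length)
open import Data.List.Membership.Propositional using (_∈_)
open import Data.List.Relation.Unary.Any using (Any)
open import Data.Product using (Σ; ∃; _×_; _,_; proj₁)
open import Data.Sum using (_⊎_)
open import Relation.Binary.PropositionalEquality using (_≡_)
open import Relation.Nullary using (¬_)

-- V : vertex type, E : adjacency relation, s : vertex where the fire
-- starts, n : number of vertices |V| (protection times range over 1..n).
-- A strategy is given as Φ : ℕ → List V, where Φ t lists the vertices v
-- with (v , t) ∈ Φ.

module Firefighter {V : Set} (E : V → V → Set) (s : V) (Φ : ℕ → List V) where

  Protected : V → ℕ → Set
  Protected v t = Σ ℕ λ t' → (1 ≤ t') × (t' ≤ t) × (v ∈ Φ t')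

  -- Nothing happens between time 0 and time 1.
  -- Step t ≥ 1: protections of time t take effect, then every vulnerable
  -- vertex adjacent to a burned vertex becomes burned at time t + 1.
  data Burned : V → ℕ → Set where
    init   : Burned s 0
    stay   : ∀ {v t} → Burned v t → Burned v (suc t)
    spread : ∀ {u v t} → 1 ≤ t → Burned u t → E u v →
             ¬ Protected v t → Burned v (suc t)

  data Path : V → V → Set where
    [] : ∀ {v} → Path v v
    _∷_ : ∀ {u w v} → E u w → Path w v → Path u v

  verts : ∀ {u v} → Path u v → List V
  verts {u} [] = u ∷ []
  verts {u} (_ ∷ p) = u ∷ verts p

  Valid : ℕ → ℕ → Set
  Valid n b =
      (Φ 0 ≡ [])
    × (∀ t → n < t → Φ t ≡ [])
    × (∀ t → length (Φ t) ≤ b)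
    × (∀ t v → v ∈ Φ t → ¬ Burned v t)

  -- saved at the end of the process (time n + 1, after the last step n)
  SavedAt : ℕ → V → Set
  SavedAt T v = Protected v T
              ⊎ (∀ u → Burned u T → (p : Path u v) →
                   Any (λ w → Protected w T) (verts p))

  Saved : ℕ → V → Set
  Saved n v = SavedAt (suc n) v

-- The tree T(r, h, d): vertices are words over Fin d of length ≤ h;
-- the root r is the empty word, the children of w are i ∷ w.

TVertex : ℕ → ℕ → Set
TVertex d h = Σ (List (Fin d)) λ w → length w ≤ h

root : ∀ {d h} → TVertex d h
root = [] , Data.Nat.z≤n

Child : ∀ {d h} → TVertex d h → TVertex d h → Set
Child {d} x y = Σ (Fin d) λ i → proj₁ x ≡ i ∷ proj₁ y

TEdge : ∀ {d h} → TVertex d h → TVertex d h → Set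
TEdge x y = Child x y ⊎ Child y x

IsLeaf : ∀ {d h} → TVertex d h → Set
IsLeaf {h = h} x = length (proj₁ x) ≡ h

treeSize : ℕ → ℕ → ℕ
treeSize d zero = 1
treeSize d (suc h) = treeSize d h + d ^ suc h

-- The
-- proof follows one burning branch from the root down to a leaf.
--
-- Invariant at time t ≤ h: some vertex x of depth t burns by time t + 1 and
-- no vertex of the subtree of x is protected by time t.  To extend the
-- branch, note that the subtrees of the b + 1 children of x are pairwise
-- disjoint, so the at most b vertices protected at time t + 1 miss one of
-- them entirely (a pigeonhole argument); that child burns at time t + 2.
-- At t = h the branch ends at a leaf which burns while unprotected, hence is
-- never protected (validity forbids protecting burned vertices) and is
-- therefore not saved: the trivial path from the leaf to itself has no
-- protected vertex.  Since h ≤ |V| the process runs long enough.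
module Submission where

open import Defs
open import Data.Nat using (ℕ; zero; suc; _≤_; _<_; _+_; _^_; z≤n; s≤s)
open import Data.Nat.Properties
  using (≤-refl; ≤-trans; n≤1+n; m≤n⇒m<n∨m≡n; ≤-<-connex; m^n>0; +-mono-≤; +-comm)
open import Data.List using (List; []; _∷_; _++_; [_]; length; lookup)
open import Data.List.Properties using (≡-dec; ++-assoc; ++-cancelʳ; ∷ʳ-injectiveʳ)
open import Data.List.Membership.Propositional using (_∈_; lose)
open import Data.List.Relation.Unary.Any using (Any; here; index; any?)
open import Data.List.Relation.Unary.Any.Properties using (lookup-index)
open import Data.Fin using (Fin)
import Data.Fin.Properties as Fin
open import Data.Product using (∃; _×_; _,_; proj₁; proj₂)
open import Data.Empty using (⊥-elim)
open import Data.Sum using (_⊎_; inj₁; inj₂)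
open import Relation.Nullary using (¬_; Dec; yes; no; ¬?)
open import Relation.Unary using (Decidable)
open import Relation.Binary.Definitions using (DecidableEquality)
open import Relation.Binary.PropositionalEquality
  using (_≡_; refl; sym; trans; cong; subst; module ≡-Reasoning)

-- Subtrees of words.  The word u lies in the subtree rooted at a when a is
-- a suffix of u (words grow at the front as one descends the tree).

module _ {A : Set} where

  Below : List A → List A → Set
  Below a u = ∃ λ w → u ≡ w ++ a

  below? : DecidableEquality A → (a u : List A) → Dec (Below a u)
  below? _≟_ a u with ≡-dec _≟_ u a
  ... | yes u≡a = yes ([] , u≡a)
  below? _≟_ a [] | no []≢a = no λ { ([] , e) → []≢a e ; (_ ∷ _ , ()) }
  below? _≟_ a (c ∷ u) | no u≢a with below? _≟_ a u
  ... | yes (w , e) = yes (c ∷ w , cong (c ∷_) e)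
  ... | no ¬below = no λ { ([] , e) → u≢a e ; (_ ∷ w , refl) → ¬below (w , refl) }

  below-parent : ∀ {i a u} → Below (i ∷ a) u → Below a u
  below-parent {i} {a} (w , e) = w ++ [ i ] , trans e (sym (++-assoc w [ i ] a))

  below-child-unique : ∀ {i j a u} → Below (i ∷ a) u → Below (j ∷ a) u → i ≡ j
  below-child-unique {i} {j} {a} (w , refl) (w′ , e) =
    ∷ʳ-injectiveʳ w w′ (++-cancelʳ a (w ++ [ i ]) (w′ ++ [ j ]) (begin
      (w ++ [ i ]) ++ a   ≡⟨ ++-assoc w [ i ] a ⟩
      w ++ i ∷ a          ≡⟨ e ⟩
      w′ ++ j ∷ a         ≡⟨ sym (++-assoc w′ [ j ] a) ⟩
      (w′ ++ [ j ]) ++ a  ∎))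
    where open ≡-Reasoning

avoid : ∀ {A : Set} {k} (P : Fin k → A → Set) → (∀ i → Decidable (P i)) →
        (∀ {i j x} → P i x → P j x → i ≡ j) →
        (L : List A) → length L < k → ∃ λ i → ¬ Any (P i) L
avoid P P? disjoint L short with Fin.any? (λ i → ¬? (any? (P? i) L))
... | yes missed = missed
... | no ¬missed =
  let (i , j , i<j , same) = Fin.pigeonhole short (λ i → index (hit i))
  in ⊥-elim (Fin.<⇒≢ i<j (disjoint (lookup-index (hit i)) (shared same)))
  where
  -- otherwise every property is witnessed somewhere in L ...
  hit : ∀ i → Any (P i) L
  hit i with any? (P? i) L
  ... | yes p = p
  ... | no ¬p = ⊥-elim (¬missed (i , ¬p))

  -- ... and two properties witnessed at the same position share an element
  shared : ∀ {i j} → index (hit i) ≡ index (hit j) → P j (lookup L (index (hit i)))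
  shared {j = j} same = subst (λ n → P j (lookup L n)) (sym same) (lookup-index (hit j))

module Process {V : Set} (E : V → V → Set) (s : V) (Φ : ℕ → List V) where
  open Firefighter E s Φ

  burned-mono : ∀ {v t t′} → t ≤ t′ → Burned v t → Burned v t′
  burned-mono {t′ = zero} z≤n B = B
  burned-mono {t′ = suc t′} t≤ B with m≤n⇒m<n∨m≡n t≤
  ... | inj₁ (s≤s t≤t′) = stay (burned-mono t≤t′ B)
  ... | inj₂ refl = B

  protected-suc : ∀ {v t} → Protected v (suc t) → Protected v t ⊎ v ∈ Φ (suc t)
  protected-suc (t′ , 1≤t′ , t′≤ , v∈) with m≤n⇒m<n∨m≡n t′≤
  ... | inj₁ (s≤s t′≤t) = inj₁ (t′ , 1≤t′ , t′≤t , v∈)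
  ... | inj₂ refl = inj₂ v∈

  never-protected : (∀ t v → v ∈ Φ t → ¬ Burned v t) →
                    ∀ {v t} → ¬ Protected v t → Burned v (suc t) → ∀ T → ¬ Protected v T
  never-protected valid {t = t} ¬prot B _ (t′ , 1≤t′ , _ , v∈) with ≤-<-connex t′ t
  ... | inj₁ t′≤t = ¬prot (t′ , 1≤t′ , t′≤t , v∈)
  ... | inj₂ t<t′ = valid t′ _ v∈ (burned-mono t<t′ B)

  -- A burning vertex that is never protected is not saved: the trivial path
  -- from it to itself meets no protected vertex.
  burning-not-saved : ∀ {v T} → Burned v T → (∀ T′ → ¬ Protected v T′) → ¬ SavedAt T v
  burning-not-saved _ ¬prot (inj₁ prot) = ¬prot _ prot
  burning-not-saved B ¬prot (inj₂ cut) with cut _ B []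
  ... | here prot = ¬prot _ prot

module Branch (b h : ℕ) (Φ : ℕ → List (TVertex (suc b) h))
              (budget : ∀ t → length (Φ t) ≤ b)
              (valid : ∀ t v → v ∈ Φ t → ¬ Firefighter.Burned TEdge root Φ v t) where
  open Firefighter TEdge root Φ
  open Process TEdge root Φ

  Vertex : Set
  Vertex = TVertex (suc b) h

  Untouched : Vertex → ℕ → Set
  Untouched x t = ∀ y → Below (proj₁ x) (proj₁ y) → ¬ Protected y t

  BurningBranch : ℕ → Set
  BurningBranch t =
    ∃ λ (x : Vertex) → length (proj₁ x) ≡ t × Burned x (suc t) × Untouched x t

  branch-start : BurningBranch 0
  branch-start = root , refl , stay init , λ { _ _ (_ , s≤s _ , () , _) }

  branch-extend : ∀ t → suc t ≤ h → BurningBranch t → BurningBranch (suc t)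
  branch-extend t t<h (x , refl , x-burns , x-untouched) =
    child , refl , child-burns , child-untouched
    where
    fresh : ∃ λ i → ¬ Any (λ y → Below (i ∷ proj₁ x) (proj₁ y)) (Φ (suc t))
    fresh = avoid (λ i y → Below (i ∷ proj₁ x) (proj₁ y))
                  (λ i y → below? Fin._≟_ (i ∷ proj₁ x) (proj₁ y))
                  below-child-unique (Φ (suc t)) (s≤s (budget (suc t)))

    child : Vertex
    child = proj₁ fresh ∷ proj₁ x , t<h

    child-untouched : Untouched child (suc t)
    child-untouched y below prot with protected-suc prot
    ... | inj₁ earlier = x-untouched y (below-parent below) earlier
    ... | inj₂ new = proj₂ fresh (lose new below)

    child-burns : Burned child (suc (suc t))
    child-burns = spread (s≤s z≤n) x-burns (inj₂ (proj₁ fresh , refl))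
                         (child-untouched child ([] , refl))

  branch-reaches : ∀ t → t ≤ h → BurningBranch t
  branch-reaches zero _ = branch-start
  branch-reaches (suc t) t<h = branch-extend t t<h (branch-reaches t (≤-trans (n≤1+n t) t<h))

  burning-leaf : ∃ λ (x : Vertex) → IsLeaf x × Burned x (suc h) × (∀ T → ¬ Protected x T)
  burning-leaf with branch-reaches h ≤-refl
  ... | x , leaf , x-burns , x-untouched =
    x , leaf , x-burns , never-protected valid (x-untouched x ([] , refl)) x-burns

height≤treeSize : ∀ d h → h ≤ treeSize (suc d) h
height≤treeSize d zero = z≤n
height≤treeSize d (suc h) =
  subst (_≤ treeSize (suc d) h + suc d ^ suc h) (+-comm h 1)
        (+-mono-≤ (height≤treeSize d h) (m^n>0 (suc d) (suc h)))

lemma1 : (b h : ℕ) → 1 ≤ b → (Φ : ℕ → List (TVertex (suc b) h)) →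
         Firefighter.Valid TEdge root Φ (treeSize (suc b) h) b →
         ∃ λ (v : TVertex (suc b) h) →
           IsLeaf v × ¬ Firefighter.Saved TEdge root Φ (treeSize (suc b) h) v
lemma1 b h _ Φ (_ , _ , budget , valid)
  with x , leaf , x-burns , never-prot ← Branch.burning-leaf b h Φ budget valid =
  x , leaf , burning-not-saved (burned-mono (s≤s (height≤treeSize b h)) x-burns) never-prot
  where open Process TEdge root Φ
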